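{- Let $\mathcal H=(V,\mathcal E)$ be a hypergraph with $V=\{1,\dots,|V|\}$ and let $\mathcal S(\mathcal H)$ be the set of binary strings constructed below. Then no maximal common subsequence of $\mathcal S(\mathcal H)$ contains $11$ as a substring (i.e. as two consecutive characters).
   Context: Hyperedges are subsets of $V$; write $\mathcal E=\{E_1,\dots,E_{|\mathcal E|}\}$. Construction of $\mathcal S(\mathcal H)=\{S_0,S_1,\dots,S_{|\mathcal E|}\}$ over $\{0,1\}$: $S_0=(01)^{|V|}$ (where $X^t$ is $X$ repeated $t$ times). For a hyperedge $E_i=\{u_1,\dots,u_h\}$ with $u_1<\dots<u_h$, $S_i=T_1T_2\cdots T_{|V|+|E_i|-1}$ where $T_j=0$ if $j=u_k+k-1$ for some $1\le k\le h$, and $T_j=01$ otherwise. A string $Y$ is a subsequence of $X$ if obtained from $X$ by deleting characters; a maximal common subsequence of a set of strings is a common subsequence not a proper subsequence of any other common subsequence. -}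

module Defs where

open import Data.Nat using (ℕ; zero; suc; _+_; _∸_)
open import Data.Bool using (Bool; true; false; if_then_else_)
open import Data.Fin using (Fin; toℕ)
open import Data.Fin.Subset using (Subset; _∈_)
open import Data.Fin.Subset.Properties using (_∈?_)
open import Data.List using (List; []; _∷_; _++_; concat; map; length; filter; allFin; upTo; zip; concatMap)
open import Data.Bool.ListAction using (any)
open import Data.List.Relation.Binary.Subset.Propositional using ()
open import Data.List.Relation.Binary.Sublist.Propositional using (_⊆_)
open import Data.List.Relation.Unary.Any as Any using (Any)
open import Data.List.Membership.Propositional renaming (_∈_ to _∈L_)
open import Data.Product using (_×_; ∃; _,_)
open import Relation.Binary.PropositionalEquality using (_≡_)
open import Relation.Nullary using (¬_)
import Data.Empty
import Data.Nat

-- Binary strings over {0,1}: false = 0, true = 1.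
BinStr : Set
BinStr = List Bool

-- Hypergraph on vertex set V = {1,…,n}: vertex (toℕ v + 1) for v : Fin n;
-- a finite list of hyperedges, each a subset of V.
record Hypergraph : Set where
  field
    n     : ℕ
    edges : List (Subset n)
open Hypergraph public

rep : ℕ → BinStr → BinStr
rep zero    X = []
rep (suc t) X = X ++ rep t X

zo : BinStr
zo = false ∷ true ∷ []

S₀ : ℕ → BinStr
S₀ n = rep n zo

sortedElems : ∀ {n} → Subset n → List ℕ
sortedElems {n} E = map (λ v → suc (toℕ v)) (filter (λ v → v ∈? E) (allFin n))

zeroPositions : List ℕ → List ℕ
zeroPositions us = go 1 us
  where
  go : ℕ → List ℕ → List ℕ
  go k []       = []
  go k (u ∷ us) = (u + k ∸ 1) ∷ go (suc k) us

-- S_i = T_1 T_2 ⋯ T_{|V|+|E_i|-1},  T_j = 0 if j is a 0-position, else 01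
Sedge : ∀ {n} → Subset n → BinStr
Sedge {n} E =
  concatMap (λ j → if any (λ p → Data.Nat._≡ᵇ_ p j) Z then false ∷ [] else zo)
            (map suc (upTo (n + length us ∸ 1)))
  where
  us = sortedElems E
  Z  = zeroPositions us

𝒮 : Hypergraph → List BinStr
𝒮 H = S₀ (n H) ∷ map Sedge (edges H)

_≼_ : BinStr → BinStr → Set
Y ≼ X = Y ⊆ X

IsCommonSubseq : List BinStr → BinStr → Set
IsCommonSubseq Ss Y = ∀ {X} → X ∈L Ss → Y ≼ X

IsMaximalCommonSubseq : List BinStr → BinStr → Set
IsMaximalCommonSubseq Ss Y =
  IsCommonSubseq Ss Y ×
  (∀ Z → IsCommonSubseq Ss Z → Y ≼ Z → Y ≡ Z)

Contains11 : BinStr → Set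
Contains11 Y = ∃ λ A → ∃ λ B → Y ≡ A ++ (true ∷ true ∷ []) ++ B

{-# OPTIONS --safe #-}
-- Every string of 𝒮(ℋ) is a concatenation of the blocks 0 and 01, so none of
-- them contains 11. If a common subsequence Y = A 11 B of such strings is
-- embedded in one of them, the second 1 lands strictly after the first and is
-- immediately preceded by a 0, which cannot be the first 1; hence A 101 B is a
-- strictly longer common subsequence containing Y, and Y is not maximal.
module Submission where

open import Defs
open import Data.Bool using (true; false; _∧_; if_then_else_)
open import Data.List using ([]; _∷_; _++_; concatMap; map; upTo; length)
open import Data.List.Properties using (++-cancelˡ)
open import Data.List.Membership.Propositional using (_∈_)
open import Data.List.Membership.Propositional.Properties using (∈-map⁻)
open import Data.List.Relation.Unary.Any using (here; there)
open import Data.List.Relation.Unary.Linked as Linked using (Linked; []; [-]; _∷_)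
open import Data.List.Relation.Binary.Sublist.Propositional using (_⊆_; _∷_; _∷ʳ_; ⊆-refl)
open import Data.List.Relation.Binary.Sublist.Propositional.Properties using (++⁺)
open import Data.Nat using (zero; suc; _+_; _∸_)
open import Data.Fin.Subset using (Subset)
open import Data.Product using (_,_)
open import Relation.Binary.PropositionalEquality using (_≡_; _≢_; refl)
open import Relation.Nullary using (¬_)

Avoids11 : BinStr → Set
Avoids11 = Linked (λ x y → x ∧ y ≡ false)

0-precedes-1 : ∀ {x xs B} → Avoids11 (x ∷ xs) → true ∷ B ⊆ xs → false ∷ true ∷ B ⊆ x ∷ xs
0-precedes-1 {false} _        (refl ∷ p) = refl ∷ refl ∷ p
0-precedes-1 {true}  (() ∷ _) (refl ∷ _)
0-precedes-1         a        (y ∷ʳ p)   = _ ∷ʳ 0-precedes-1 (Linked.tail a) p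

separate-11 : ∀ A {xs B} → Avoids11 xs →
              A ++ true ∷ true ∷ B ⊆ xs → A ++ true ∷ false ∷ true ∷ B ⊆ xs
separate-11 []      (() ∷ _) (refl ∷ refl ∷ _)
separate-11 []      (_ ∷ a)  (refl ∷ (_ ∷ʳ p)) = refl ∷ 0-precedes-1 a p
separate-11 (_ ∷ A) a        (x≡y ∷ p)         = x≡y ∷ separate-11 A (Linked.tail a) p
separate-11 A       a        (x ∷ʳ p)          = x ∷ʳ separate-11 A (Linked.tail a) p

maximal-common-subseq-avoids-11 : ∀ {Ss Y} → (∀ {X} → X ∈ Ss → Avoids11 X) →
                                  IsMaximalCommonSubseq Ss Y → ¬ Contains11 Y
maximal-common-subseq-avoids-11 avoids (common , maximal) (A , B , refl) =
  11≢101 (maximal _ separated-common (++⁺ ⊆-refl (refl ∷ false ∷ʳ ⊆-refl)))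
  where
  separated-common : IsCommonSubseq _ (A ++ true ∷ false ∷ true ∷ B)
  separated-common X∈Ss = separate-11 A (avoids X∈Ss) (common X∈Ss)

  11≢101 : A ++ true ∷ true ∷ B ≢ A ++ true ∷ false ∷ true ∷ B
  11≢101 eq with () ← ++-cancelˡ A _ _ eq

data Blocks : BinStr → Set where
  []     : Blocks []
  ⟨0⟩∷_  : ∀ {xs} → Blocks xs → Blocks (false ∷ xs)
  ⟨01⟩∷_ : ∀ {xs} → Blocks xs → Blocks (false ∷ true ∷ xs)

Blocks-++ : ∀ {xs ys} → Blocks xs → Blocks ys → Blocks (xs ++ ys)
Blocks-++ []         bs = bs
Blocks-++ (⟨0⟩∷ as)  bs = ⟨0⟩∷ Blocks-++ as bs
Blocks-++ (⟨01⟩∷ as) bs = ⟨01⟩∷ Blocks-++ as bs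

Blocks-concatMap : ∀ {A : Set} {f : A → BinStr} →
                   (∀ j → Blocks (f j)) → ∀ js → Blocks (concatMap f js)
Blocks-concatMap bf []       = []
Blocks-concatMap bf (j ∷ js) = Blocks-++ (bf j) (Blocks-concatMap bf js)

Blocks⇒Avoids11 : ∀ {xs} → Blocks xs → Avoids11 xs
Blocks⇒Avoids11 []                   = []
Blocks⇒Avoids11 (⟨0⟩∷ [])            = [-]
Blocks⇒Avoids11 (⟨0⟩∷ bs@(⟨0⟩∷ _))   = refl ∷ Blocks⇒Avoids11 bs
Blocks⇒Avoids11 (⟨0⟩∷ bs@(⟨01⟩∷ _))  = refl ∷ Blocks⇒Avoids11 bs
Blocks⇒Avoids11 (⟨01⟩∷ [])           = refl ∷ [-]
Blocks⇒Avoids11 (⟨01⟩∷ bs@(⟨0⟩∷ _))  = refl ∷ refl ∷ Blocks⇒Avoids11 bs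
Blocks⇒Avoids11 (⟨01⟩∷ bs@(⟨01⟩∷ _)) = refl ∷ refl ∷ Blocks⇒Avoids11 bs

Blocks-S₀ : ∀ t → Blocks (S₀ t)
Blocks-S₀ zero    = []
Blocks-S₀ (suc t) = ⟨01⟩∷ Blocks-S₀ t

Blocks-Sedge : ∀ {k} (E : Subset k) → Blocks (Sedge E)
Blocks-Sedge {k} E =
  Blocks-concatMap (λ _ → Blocks-T _) (map suc (upTo (k + length (sortedElems E) ∸ 1)))
  where
  Blocks-T : ∀ b → Blocks (if b then false ∷ [] else zo)
  Blocks-T true  = ⟨0⟩∷ []
  Blocks-T false = ⟨01⟩∷ []

Blocks-𝒮 : ∀ H {X} → X ∈ 𝒮 H → Blocks X
Blocks-𝒮 H (here refl)     = Blocks-S₀ (n H)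
Blocks-𝒮 H (there X∈edges) with E , _ , refl ← ∈-map⁻ Sedge X∈edges = Blocks-Sedge E

mainTheorem15 : (H : Hypergraph) (Y : BinStr) →
    IsMaximalCommonSubseq (𝒮 H) Y → ¬ Contains11 Y
mainTheorem15 H _ = maximal-common-subseq-avoids-11 (λ X∈𝒮 → Blocks⇒Avoids11 (Blocks-𝒮 H X∈𝒮))
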